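{- Let $n>1$ be an integer, let $A$ be an $n\times n$ consistent pairwise comparison matrix, and let $B\subseteq C_n$ be a set of generators of $A$ with exactly $n-1$ elements. Then: (1) if $h(B)=0$ then $n=2$; (2) $h(B)\neq 1$; (3) if $h(B)=2$ then $G_B$ is a path passing through all $n$ vertices (a Hamiltonian path of the vertex set $\{1,\dots,n\}$).
   Context: An $n\times n$ pairwise comparison (PC) matrix is a real matrix $A=[a_{ij}]$ with $a_{ij}>0$ for all $i,j$. It is consistent if $a_{ij}a_{jk}=a_{ik}$ for all $i,j,k\in\{1,\dots,n\}$. Let $C_n=\{(i,j):1\le i<j\le n\}$. A subset $B\subseteq C_n$ is a set of generators of a consistent PC matrix $A$ if every consistent $n\times n$ PC matrix $A'$ with $a'_{ij}=a_{ij}$ for all $(i,j)\in B$ equals $A$. For $B\subseteq C_n$, $G_B$ is the undirected simple graph on vertex set $\{1,\dots,n\}$ with edge $\{i,j\}$ ($i<j$) iff $(i,j)\in B$. For $i\in\{1,\dots,n\}$, the frequency $f(i,B)$ is the number of pairs $(j,k)\in B$ with $j=i$ or $k=i$ (equivalently the degree of $i$ in $G_B$). Let $O(B)=\{i: f(i,B)>0\}$. The total handicapping of $B$ is $h(B)=\sum_{i\in O(B)}\big(\max_{j\in O(B)} f(j,B) - f(i,B)\big)$.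
   Formalization: The PC matrix $A$ and the consistent PC matrices $A'$ in the definition of a set of generators have rational entries instead of real ones. -}

module Defs where

open import Data.Nat using (ℕ; zero; suc; _<_; _<ᵇ_; _⊔_; _∸_)
open import Data.Fin using (Fin; toℕ; _≟_)
open import Data.Bool using (Bool; _∨_; if_then_else_)
open import Data.Nat.ListAction using (sum)
open import Data.List using (List; []; _∷_; length; map; foldr; filterᵇ; allFin)
open import Data.List.Relation.Unary.All using (All)
open import Data.List.Membership.Propositional using (_∈_)
open import Data.Product using (_×_; _,_; Σ; ∃)
open import Data.Sum using (_⊎_)
open import Data.Rational as ℚ using (ℚ; 0ℚ)
open import Relation.Nullary.Decidable using (⌊_⌋)
open import Relation.Binary.PropositionalEquality using (_≡_)
open import Function.Definitions using (Injective)

-- An n×n real matrix; real entries are modelled by rationals.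
Matrix : ℕ → Set
Matrix n = Fin n → Fin n → ℚ

IsPC : ∀ {n} → Matrix n → Set
IsPC A = ∀ i j → 0ℚ ℚ.< A i j

Consistent : ∀ {n} → Matrix n → Set
Consistent A = ∀ i j k → A i j ℚ.* A j k ≡ A i k

-- a finite set of index pairs, represented as a duplicate-free list (Unique imposed separately)
PairSet : ℕ → Set
PairSet n = List (Fin n × Fin n)

-- B ⊆ C_n : every pair (i , j) in B has i < j
SubsetOfC : ∀ {n} → PairSet n → Set
SubsetOfC B = All (λ p → toℕ (Data.Product.proj₁ p) < toℕ (Data.Product.proj₂ p)) B

IsGenerators : ∀ {n} → Matrix n → PairSet n → Set
IsGenerators {n} A B =
  (A' : Matrix n) → IsPC A' → Consistent A' →
  (∀ i j → (i , j) ∈ B → A' i j ≡ A i j) →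
  ∀ i j → A' i j ≡ A i j

freq : ∀ {n} → PairSet n → Fin n → ℕ
freq B i = length (filterᵇ (λ p → ⌊ Data.Product.proj₁ p ≟ i ⌋ ∨ ⌊ Data.Product.proj₂ p ≟ i ⌋) B)

occ : ∀ {n} → PairSet n → List (Fin n)
occ {n} B = filterᵇ (λ i → 0 <ᵇ freq B i) (allFin n)

-- max_{j ∈ O(B)} f(j,B)  (0 if O(B) is empty)
maxFreq : ∀ {n} → PairSet n → ℕ
maxFreq B = foldr _⊔_ 0 (map (freq B) (occ B))

handicap : ∀ {n} → PairSet n → ℕ
handicap B = sum (map (λ i → maxFreq B ∸ freq B i) (occ B))

Edge : ∀ {n} → PairSet n → Fin n → Fin n → Set
Edge B i j = ((i , j) ∈ B) ⊎ ((j , i) ∈ B)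

PathAdj : ∀ {n} → (Fin n → Fin n) → Fin n → Fin n → Set
PathAdj {n} σ i j = Σ (Fin n) λ k → Σ (Fin n) λ k' →
  (toℕ k' ≡ suc (toℕ k)) × (((σ k ≡ i) × (σ k' ≡ j)) ⊎ ((σ k ≡ j) × (σ k' ≡ i)))

-- G_B is a path visiting all n vertices: there is an ordering σ of all vertices
-- (injective, hence a bijection of Fin n) such that the edges of G_B are exactly
-- the pairs of consecutive vertices.
IsHamiltonianPath : ∀ {n} → PairSet n → Set
IsHamiltonianPath {n} B = Σ (Fin n → Fin n) λ σ → Injective _≡_ _≡_ σ ×
  (∀ i j → (Edge B i j → PathAdj σ i j) × (PathAdj σ i j → Edge B i j))

{-# OPTIONS --safe #-}
-- A set of generators makes G_B connected: if some 2-colouring of the vertices were constant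
-- along B, conjugating A by the diagonal matrix with entries 2 on one colour class and 1 on
-- the other would give a second consistent matrix agreeing with A on B.  Hence no vertex is
-- isolated, O(B) is every vertex, and the handshake lemma turns the definition of h(B) into
-- h(B) + 2(n - 1) = n Δ with Δ the maximal degree.  This excludes h(B) = 1, forces n = 2 when
-- h(B) = 0 and Δ = 2 when h(B) = 2.  In the last case some vertex is a leaf.  The walk from
-- it that never turns back stays simple, and it cannot get stuck early: the vertices visited
-- before a dead end would be closed under G_B, hence all of them by connectivity.  So the
-- walk lists the vertices along a Hamiltonian path.
module Submission where

open import Defs
import Data.Nat.Properties as ℕₚ
import Data.Rational.Properties as ℚₚ
open import Algebra.Bundles using (CommutativeMonoid)
open import Algebra.Properties.CommutativeMonoid.Sum ℕₚ.+-0-commutativeMonoid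
  using (sum-syntax; ∑-distrib-+; sum-cong-≗; sum-replicate-zero)
open import Algebra.Properties.CommutativeSemigroup (CommutativeMonoid.commutativeSemigroup ℚₚ.*-1-commutativeMonoid)
  using (interchange)
open import Data.Bool using (Bool; true; false; _∨_; T; T?; if_then_else_)
open import Data.Bool.Properties using (T-∨; ∨-identityʳ)
open import Data.Fin as Fin using (Fin; toℕ; fromℕ<; _≟_; punchOut)
import Data.Fin.Properties as Finₚ
open import Data.List using (List; []; _∷_; length; map; foldr; filterᵇ; allFin; tabulate; _++_)
open import Data.List.Properties using (length-map; map-tabulate; filter-all; length-++-sucʳ)
open import Data.List.Membership.Propositional using (_∈_)
open import Data.List.Membership.Propositional.Properties
  using (∈-allFin; ∈-map⁺; ∈-map⁻; ∈-filter⁺; ∈-filter⁻; ∈-∃++; ∈-++⁻; ∈-++⁺ˡ; ∈-++⁺ʳ)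
open import Data.List.Relation.Unary.All as All using (All; []; _∷_)
open import Data.List.Relation.Unary.AllPairs using ([]; _∷_)
open import Data.List.Relation.Unary.Any using (here; there)
open import Data.List.Relation.Unary.Unique.Propositional using (Unique)
import Data.List.Relation.Unary.Unique.Propositional.Properties as Uniqueₚ
open import Data.Nat as ℕ using (ℕ; zero; suc; _+_; _*_; _∸_; _⊔_; _≤_; _<_; _≤?_; _<?_; z≤n; s≤s)
open import Data.Nat.ListAction using (sum)
open import Data.Product using (_×_; _,_; proj₁; proj₂; ∃; ∃₂)
open import Data.Rational as ℚ using (ℚ; 0ℚ; 1ℚ; ½)
open import Data.Sum using (_⊎_; inj₁; inj₂; swap; map₂)
open import Function using (_∘_; Injective; Equivalence; mk⇔)
open import Level using (0ℓ)
open import Relation.Binary.Definitions using (tri<; tri≈; tri>)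
open import Relation.Binary.PropositionalEquality
open import Relation.Nullary using (yes; no; does; proof; contradiction)
open import Relation.Nullary.Reflects using (Reflects; invert)
open import Relation.Nullary.Decidable using (⌊_⌋; toWitness; fromWitness; dec-true; does-⇔; ⌊⌋-map′)
open import Relation.Unary using (Pred; Decidable)

Connected : ∀ {n} → PairSet n → Set
Connected {n} B =
  (S : Fin n → Bool) → (∀ {i j} → (i , j) ∈ B → S i ≡ S j) → ∀ i j → S i ≡ S j

Edge-sym : ∀ {n} {B : PairSet n} {a b} → Edge B a b → Edge B b a
Edge-sym = swap

-- d a / d b for the diagonal scaling d true = 2, d false = 1.
ratio : Bool → Bool → ℚ
ratio true  false = 1ℚ ℚ.+ 1ℚ
ratio false true  = ½
ratio _     _     = 1ℚ

ratio-refl : ∀ a → ratio a a ≡ 1ℚ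
ratio-refl true  = refl
ratio-refl false = refl

ratio-trans : ∀ a b c → ratio a b ℚ.* ratio b c ≡ ratio a c
ratio-trans true  true  true  = refl
ratio-trans true  true  false = refl
ratio-trans true  false true  = refl
ratio-trans true  false false = refl
ratio-trans false true  true  = refl
ratio-trans false true  false = refl
ratio-trans false false true  = refl
ratio-trans false false false = refl

ratio-positive : ∀ a b → 0ℚ ℚ.< ratio a b
ratio-positive true  true  = ℚₚ.positive⁻¹ _
ratio-positive true  false = ℚₚ.positive⁻¹ _
ratio-positive false true  = ℚₚ.positive⁻¹ _
ratio-positive false false = ℚₚ.positive⁻¹ _

ratio≡1⇒≡ : ∀ {a b} → ratio a b ≡ 1ℚ → a ≡ b
ratio≡1⇒≡ {true}  {true}  _ = refl
ratio≡1⇒≡ {false} {false} _ = refl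
ratio≡1⇒≡ {true}  {false} ()
ratio≡1⇒≡ {false} {true}  ()

*-pos : ∀ {p q} → 0ℚ ℚ.< p → 0ℚ ℚ.< q → 0ℚ ℚ.< p ℚ.* q
*-pos {p} {q} p>0 q>0 =
  ℚₚ.positive⁻¹ _ {{ℚₚ.pos*pos⇒pos p {{ℚ.positive p>0}} q {{ℚ.positive q>0}}}}

p*r≡p⇒r≡1 : ∀ {p r} → 0ℚ ℚ.< p → p ℚ.* r ≡ p → r ≡ 1ℚ
p*r≡p⇒r≡1 {p} {r} p>0 p*r≡p with ℚₚ.<-cmp r 1ℚ
... | tri< r<1 _ _ = contradiction (trans p*r≡p (sym (ℚₚ.*-identityʳ p)))
                       (ℚₚ.<⇒≢ (ℚₚ.*-monoʳ-<-pos p {{ℚ.positive p>0}} r<1))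
... | tri≈ _ r≡1 _ = r≡1
... | tri> _ _ r>1 = contradiction (trans (ℚₚ.*-identityʳ p) (sym p*r≡p))
                       (ℚₚ.<⇒≢ (ℚₚ.*-monoʳ-<-pos p {{ℚ.positive p>0}} r>1))

module _ {n} {A : Matrix n} (pc : IsPC A) (cons : Consistent A) (S : Fin n → Bool) where

  rescale : Matrix n
  rescale i j = A i j ℚ.* ratio (S i) (S j)

  rescale-PC : IsPC rescale
  rescale-PC i j = *-pos (pc i j) (ratio-positive (S i) (S j))

  rescale-consistent : Consistent rescale
  rescale-consistent i j k =
    trans (interchange (A i j) _ (A j k) _) (cong₂ ℚ._*_ (cons i j k) (ratio-trans (S i) (S j) (S k)))

generators⇒connected : ∀ {n} {A : Matrix n} {B : PairSet n} →
  IsPC A → Consistent A → IsGenerators A B → Connected B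
generators⇒connected {A = A} pc cons gen S S-closed i j =
  ratio≡1⇒≡ (p*r≡p⇒r≡1 (pc i j)
    (gen (rescale pc cons S) (rescale-PC pc cons S) (rescale-consistent pc cons S) agrees i j))
  where
  agrees : ∀ x y → (x , y) ∈ _ → rescale pc cons S x y ≡ A x y
  agrees x y xy∈B = begin
    A x y ℚ.* ratio (S x) (S y) ≡⟨ cong (λ s → A x y ℚ.* ratio s (S y)) (S-closed xy∈B) ⟩
    A x y ℚ.* ratio (S y) (S y) ≡⟨ cong (A x y ℚ.*_) (ratio-refl (S y)) ⟩
    A x y ℚ.* 1ℚ                ≡⟨ ℚₚ.*-identityʳ (A x y) ⟩
    A x y                       ∎
    where open ≡-Reasoning

closed⇒universal : ∀ {n} {B : PairSet n} → Connected B →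
  {P : Pred (Fin n) 0ℓ} → Decidable P → (∀ {a b} → Edge B a b → P a → P b) →
  ∀ {x} → P x → ∀ y → P y
closed⇒universal {B = B} conn {P} P? closed {x} px y =
  invert (subst (Reflects (P y)) S[y]≡true (proof (P? y)))
  where
  S : Fin _ → Bool
  S v = does (P? v)
  S-closed : ∀ {i j} → (i , j) ∈ B → S i ≡ S j
  S-closed {i} {j} ij∈B = does-⇔ (mk⇔ (closed (inj₁ ij∈B)) (closed (inj₂ ij∈B))) (P? i) (P? j)
  S[y]≡true : S y ≡ true
  S[y]≡true = trans (sym (conn S S-closed x y)) (dec-true (P? x) px)

unique-⊆⇒length-≤ : ∀ {A : Set} {xs ys : List A} →
  Unique xs → (∀ {z} → z ∈ xs → z ∈ ys) → length xs ≤ length ys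
unique-⊆⇒length-≤ {xs = []}     _           _    = z≤n
unique-⊆⇒length-≤ {xs = x ∷ xs} (x∉xs ∷ xs!) xs⊆ys with ∈-∃++ (xs⊆ys (here refl))
... | ys₁ , ys₂ , refl =
  subst (suc (length xs) ≤_) (sym (length-++-sucʳ ys₁ x ys₂)) (s≤s (unique-⊆⇒length-≤ xs! xs⊆ys₁++ys₂))
  where
  xs⊆ys₁++ys₂ : ∀ {z} → z ∈ xs → z ∈ ys₁ ++ ys₂
  xs⊆ys₁++ys₂ z∈xs with ∈-++⁻ ys₁ (xs⊆ys (there z∈xs))
  ... | inj₁ z∈ys₁          = ∈-++⁺ˡ z∈ys₁
  ... | inj₂ (here refl)    = contradiction refl (All.lookup x∉xs z∈xs)
  ... | inj₂ (there z∈ys₂)  = ∈-++⁺ʳ ys₁ z∈ys₂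

nonempty⇒∈ : ∀ {A : Set} (xs : List A) → 1 ≤ length xs → ∃ (_∈ xs)
nonempty⇒∈ (x ∷ _) _ = x , here refl

unique⇒two-distinct : ∀ {A : Set} {xs : List A} → Unique xs → 2 ≤ length xs →
  ∃₂ λ x y → x ∈ xs × y ∈ xs × x ≢ y
unique⇒two-distinct {xs = x ∷ y ∷ _} ((x≢y ∷ _) ∷ _) _ = x , y , here refl , there (here refl) , x≢y
unique⇒two-distinct {xs = _ ∷ []} _ (s≤s ())

∈⇒≤foldr-⊔ : ∀ {x xs} → x ∈ xs → x ≤ foldr _⊔_ 0 xs
∈⇒≤foldr-⊔ {xs = y ∷ _}  (here refl) = ℕₚ.m≤m⊔n y _
∈⇒≤foldr-⊔ {xs = y ∷ _}  (there x∈xs) = ℕₚ.m≤n⇒m≤o⊔n y (∈⇒≤foldr-⊔ x∈xs)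

sum-tabulate : ∀ n (f : Fin n → ℕ) → sum (tabulate f) ≡ ∑[ i < n ] f i
sum-tabulate zero    f = refl
sum-tabulate (suc n) f = cong (f Fin.zero +_) (sum-tabulate n (f ∘ Fin.suc))

sum-map-allFin : ∀ n (f : Fin n → ℕ) → sum (map f (allFin n)) ≡ ∑[ i < n ] f i
sum-map-allFin n f = trans (cong sum (map-tabulate (λ i → i) f)) (sum-tabulate n f)

∑-const : ∀ n c → ∑[ i < n ] c ≡ n * c
∑-const zero    c = refl
∑-const (suc n) c = cong (c +_) (∑-const n c)

InjectiveUpTo : ∀ {A : Set} → (ℕ → A) → ℕ → Set
InjectiveUpTo f k = ∀ {i j} → i ≤ k → j ≤ k → f i ≡ f j → i ≡ j

injectiveUpTo-suc : ∀ {A : Set} {f : ℕ → A} {k} → InjectiveUpTo f k →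
  (∀ {j} → j ≤ k → f j ≢ f (suc k)) → InjectiveUpTo f (suc k)
injectiveUpTo-suc inj fresh i≤k+1 j≤k+1 fi≡fj
  with ℕₚ.m≤n⇒m<n∨m≡n i≤k+1 | ℕₚ.m≤n⇒m<n∨m≡n j≤k+1
... | inj₁ i<k+1 | inj₁ j<k+1 = inj (ℕₚ.≤-pred i<k+1) (ℕₚ.≤-pred j<k+1) fi≡fj
... | inj₁ i<k+1 | inj₂ refl  = contradiction fi≡fj (fresh (ℕₚ.≤-pred i<k+1))
... | inj₂ refl  | inj₁ j<k+1 = contradiction (sym fi≡fj) (fresh (ℕₚ.≤-pred j<k+1))
... | inj₂ refl  | inj₂ refl  = refl

covered⇒≤ : ∀ {n l} (f : ℕ → Fin n) → (∀ v → ∃ λ j → j < l × f j ≡ v) → n ≤ l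
covered⇒≤ {n} {l} f cover = Finₚ.injective⇒≤ index-injective
  where
  index : Fin n → Fin l
  index v = fromℕ< (proj₁ (proj₂ (cover v)))
  index-injective : Injective _≡_ _≡_ index
  index-injective {u} {v} eq = begin
    u                      ≡⟨ proj₂ (proj₂ (cover u)) ⟨
    f (proj₁ (cover u))    ≡⟨ cong f (Finₚ.fromℕ<-injective _ _ _ _ eq) ⟩
    f (proj₁ (cover v))    ≡⟨ proj₂ (proj₂ (cover v)) ⟩
    v                      ∎
    where open ≡-Reasoning

injective⇒surjective : ∀ {n} {f : Fin n → Fin n} → Injective _≡_ _≡_ f → ∀ v → ∃ λ a → f a ≡ v
injective⇒surjective {suc n} {f} f-injective v with Finₚ.any? (λ a → f a ≟ v)
... | yes hit  = hit
... | no  miss = contradiction (Finₚ.injective⇒≤ punched-injective) ℕₚ.1+n≰n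
  where
  v≢f : ∀ a → v ≢ f a
  v≢f a = miss ∘ (a ,_) ∘ sym
  punched : Fin (suc n) → Fin n
  punched a = punchOut (v≢f a)
  punched-injective : Injective _≡_ _≡_ punched
  punched-injective {a} {b} eq = f-injective (Finₚ.punchOut-injective (v≢f a) (v≢f b) eq)

1≤x≤2∧x≢1⇒x≡2 : ∀ {x} → 1 ≤ x → x ≤ 2 → x ≢ 1 → x ≡ 2
1≤x≤2∧x≢1⇒x≡2 (s≤s z≤n) (s≤s z≤n)       x≢1 = contradiction refl x≢1
1≤x≤2∧x≢1⇒x≡2 (s≤s z≤n) (s≤s (s≤s z≤n)) _   = refl

𝟙 : Bool → ℕ
𝟙 b = if b then 1 else 0

length-filterᵇ-∷ : ∀ {A : Set} (p : A → Bool) x xs →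
  length (filterᵇ p (x ∷ xs)) ≡ 𝟙 (p x) + length (filterᵇ p xs)
length-filterᵇ-∷ p x xs with p x
... | true  = refl
... | false = refl

⌊suc≟suc⌋ : ∀ {n} (x i : Fin n) → ⌊ Fin.suc x ≟ Fin.suc i ⌋ ≡ ⌊ x ≟ i ⌋
⌊suc≟suc⌋ x i = ⌊⌋-map′ (cong Fin.suc) Finₚ.suc-injective (x ≟ i)

∑-𝟙-≟ : ∀ {n} (x : Fin n) → ∑[ i < n ] 𝟙 ⌊ x ≟ i ⌋ ≡ 1
∑-𝟙-≟ {suc n} Fin.zero    = cong suc (sum-replicate-zero n)
∑-𝟙-≟ {suc n} (Fin.suc x) =
  trans (sum-cong-≗ (λ i → cong 𝟙 (⌊suc≟suc⌋ x i))) (∑-𝟙-≟ x)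

∑-𝟙-≟∨≟ : ∀ {n} {x y : Fin n} → x ≢ y → ∑[ i < n ] 𝟙 (⌊ x ≟ i ⌋ ∨ ⌊ y ≟ i ⌋) ≡ 2
∑-𝟙-≟∨≟ {suc n} {Fin.zero}  {Fin.zero}  x≢y = contradiction refl x≢y
∑-𝟙-≟∨≟ {suc n} {Fin.zero}  {Fin.suc y} _   =
  cong suc (trans (sum-cong-≗ (λ i → cong 𝟙 (⌊suc≟suc⌋ y i))) (∑-𝟙-≟ y))
∑-𝟙-≟∨≟ {suc n} {Fin.suc x} {Fin.zero}  _   =
  cong suc (trans (sum-cong-≗ (λ i → cong 𝟙 (trans (∨-identityʳ _) (⌊suc≟suc⌋ x i)))) (∑-𝟙-≟ x))
∑-𝟙-≟∨≟ {suc n} {Fin.suc x} {Fin.suc y} x≢y =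
  trans (sum-cong-≗ (λ i → cong₂ (λ b c → 𝟙 (b ∨ c)) (⌊suc≟suc⌋ x i) (⌊suc≟suc⌋ y i)))
        (∑-𝟙-≟∨≟ (x≢y ∘ cong Fin.suc))

incident : ∀ {n} → Fin n → Fin n × Fin n → Bool
incident i (x , y) = ⌊ x ≟ i ⌋ ∨ ⌊ y ≟ i ⌋

handshake : ∀ {n} (L : PairSet n) → SubsetOfC L → ∑[ i < n ] freq L i ≡ 2 * length L
handshake {n} []            _            = sum-replicate-zero n
handshake {n} ((x , y) ∷ L) (x<y ∷ L⊆C) = begin
  ∑[ i < n ] freq ((x , y) ∷ L) i
    ≡⟨ sum-cong-≗ (λ i → length-filterᵇ-∷ (incident i) (x , y) L) ⟩
  ∑[ i < n ] (𝟙 (incident i (x , y)) + freq L i)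
    ≡⟨ ∑-distrib-+ (λ i → 𝟙 (incident i (x , y))) (freq L) ⟩
  ∑[ i < n ] 𝟙 (incident i (x , y)) + ∑[ i < n ] freq L i
    ≡⟨ cong₂ _+_ (∑-𝟙-≟∨≟ (λ x≡y → ℕₚ.<-irrefl (cong toℕ x≡y) x<y)) (handshake L L⊆C) ⟩
  2 + 2 * length L
    ≡⟨ sym (ℕₚ.*-suc 2 (length L)) ⟩
  2 * length ((x , y) ∷ L) ∎
  where open ≡-Reasoning

orient : ∀ {n} → Fin n → Fin n → Fin n × Fin n
orient a b with toℕ a <? toℕ b
... | yes _ = a , b
... | no  _ = b , a

orient-< : ∀ {n} {a b : Fin n} → toℕ a < toℕ b → orient a b ≡ (a , b)
orient-< {a = a} {b} a<b with toℕ a <? toℕ b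
... | yes _   = refl
... | no  a≮b = contradiction a<b a≮b

orient-> : ∀ {n} {a b : Fin n} → toℕ b < toℕ a → orient a b ≡ (b , a)
orient-> {a = a} {b} b<a with toℕ a <? toℕ b
... | yes a<b = contradiction a<b (ℕₚ.<⇒≯ b<a)
... | no  _   = refl

orient-injective : ∀ {n} {a b c : Fin n} → orient a b ≡ orient a c → b ≡ c
orient-injective {a = a} {b} {c} eq with toℕ a <? toℕ b | toℕ a <? toℕ c
... | yes _ | yes _ = cong proj₂ eq
... | yes _ | no  _ = trans (cong proj₂ eq) (cong proj₁ eq)
... | no  _ | yes _ = trans (cong proj₁ eq) (cong proj₂ eq)
... | no  _ | no  _ = cong proj₁ eq

incident-orient : ∀ {n} (a b : Fin n) → T (incident a (orient a b))
incident-orient a b with toℕ a <? toℕ b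
... | yes _ = Equivalence.from T-∨ (inj₁ (fromWitness {a? = a ≟ a} refl))
... | no  _ = Equivalence.from T-∨ (inj₂ (fromWitness {a? = a ≟ a} refl))

module Degrees {n} {B : PairSet n} (B⊆C : SubsetOfC B) where

  ordered : ∀ {a b} → (a , b) ∈ B → toℕ a < toℕ b
  ordered = All.lookup B⊆C

  Edge⇒≢ : ∀ {a b} → Edge B a b → a ≢ b
  Edge⇒≢ (inj₁ ab∈B) refl = ℕₚ.<-irrefl refl (ordered ab∈B)
  Edge⇒≢ (inj₂ ba∈B) refl = ℕₚ.<-irrefl refl (ordered ba∈B)

  incidences : Fin n → PairSet n
  incidences a = filterᵇ (incident a) B

  Edge⇒orient∈B : ∀ {a b} → Edge B a b → orient a b ∈ B
  Edge⇒orient∈B (inj₁ ab∈B) = subst (_∈ B) (sym (orient-< (ordered ab∈B))) ab∈B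
  Edge⇒orient∈B (inj₂ ba∈B) = subst (_∈ B) (sym (orient-> (ordered ba∈B))) ba∈B

  incidence⇒Edge : ∀ {a p} → p ∈ incidences a → ∃ λ b → Edge B a b × orient a b ≡ p
  incidence⇒Edge {a} {x , y} p∈ with ∈-filter⁻ (T? ∘ incident a) p∈
  ... | xy∈B , a∈xy with Equivalence.to T-∨ a∈xy
  ... | inj₁ x≡a with refl ← toWitness {a? = x ≟ a} x≡a = y , inj₁ xy∈B , orient-< (ordered xy∈B)
  ... | inj₂ y≡a with refl ← toWitness {a? = y ≟ a} y≡a = x , inj₂ xy∈B , orient-> (ordered xy∈B)

  distinct-neighbours≤freq : ∀ {a bs} → Unique bs → All (Edge B a) bs → length bs ≤ freq B a
  distinct-neighbours≤freq {a} {bs} bs! edges = begin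
    length bs                  ≡⟨ length-map (orient a) bs ⟨
    length (map (orient a) bs) ≤⟨ unique-⊆⇒length-≤ (Uniqueₚ.map⁺ orient-injective bs!) ⊆incidences ⟩
    freq B a                   ∎
    where
    open ℕₚ.≤-Reasoning
    ⊆incidences : ∀ {p} → p ∈ map (orient a) bs → p ∈ incidences a
    ⊆incidences p∈ with ∈-map⁻ (orient a) p∈
    ... | b , b∈bs , refl =
      ∈-filter⁺ (T? ∘ incident a) (Edge⇒orient∈B (All.lookup edges b∈bs)) (incident-orient a b)

  Edge⇒freq≥1 : ∀ {a b} → Edge B a b → 1 ≤ freq B a
  Edge⇒freq≥1 ab = distinct-neighbours≤freq ([] ∷ []) (ab ∷ [])

  freq≤1⇒neighbour-unique : ∀ {a b c} → freq B a ≤ 1 → Edge B a b → Edge B a c → b ≡ c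
  freq≤1⇒neighbour-unique {b = b} {c} freq≤1 ab ac with b ≟ c
  ... | yes b≡c = b≡c
  ... | no  b≢c = contradiction (distinct-neighbours≤freq ((b≢c ∷ []) ∷ [] ∷ []) (ab ∷ ac ∷ []))
                                (ℕₚ.<⇒≱ (s≤s freq≤1))

  freq≤2⇒neighbour∈ : ∀ {a b c x} → freq B a ≤ 2 → Edge B a b → Edge B a c → b ≢ c →
    Edge B a x → x ≡ b ⊎ x ≡ c
  freq≤2⇒neighbour∈ {b = b} {c} {x} freq≤2 ab ac b≢c ax with x ≟ b | x ≟ c
  ... | yes x≡b | _       = inj₁ x≡b
  ... | no  _   | yes x≡c = inj₂ x≡c
  ... | no  x≢b | no  x≢c =
    contradiction (distinct-neighbours≤freq ((x≢b ∷ x≢c ∷ []) ∷ (b≢c ∷ []) ∷ [] ∷ []) (ax ∷ ab ∷ ac ∷ []))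
                  (ℕₚ.<⇒≱ (s≤s freq≤2))

  freq≥1⇒neighbour : ∀ {a} → 1 ≤ freq B a → ∃ (Edge B a)
  freq≥1⇒neighbour {a} freq≥1 with nonempty⇒∈ (incidences a) freq≥1
  ... | _ , p∈ with incidence⇒Edge p∈
  ... | b , ab , _ = b , ab

  freq≥2⇒other-neighbour : Unique B → ∀ {a} → 2 ≤ freq B a → ∀ b → ∃ λ c → Edge B a c × c ≢ b
  freq≥2⇒other-neighbour B! {a} freq≥2 b
    with unique⇒two-distinct (Uniqueₚ.filter⁺ (T? ∘ incident a) B!) freq≥2
  ... | p , q , p∈ , q∈ , p≢q with incidence⇒Edge p∈ | incidence⇒Edge q∈
  ... | c , ac , refl | d , ad , refl with c ≟ b
  ... | no  c≢b = c , ac , c≢b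
  ... | yes refl = d , ad , λ { refl → p≢q refl }

module _ {n} (B : PairSet n) where

  connected⇒freq≥1 : SubsetOfC B → 1 < n → Connected B → ∀ a → 1 ≤ freq B a
  connected⇒freq≥1 B⊆C (s≤s (s≤s _)) conn a with 1 ≤? freq B a
  ... | yes freq≥1 = freq≥1
  ... | no  freq≱1 = contradiction (trans (only-a Fin.zero) (sym (only-a (Fin.suc Fin.zero)))) λ ()
    where
    open Degrees B⊆C
    only-a : ∀ y → y ≡ a
    only-a = closed⇒universal conn (_≟ a) (λ { ab refl → contradiction (Edge⇒freq≥1 ab) freq≱1 }) refl

  freq≤maxFreq : ∀ {a} → 1 ≤ freq B a → freq B a ≤ maxFreq B
  freq≤maxFreq {a} freq≥1 = ∈⇒≤foldr-⊔ (∈-map⁺ (freq B) a∈occ)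
    where
    a∈occ : a ∈ occ B
    a∈occ = ∈-filter⁺ (T? ∘ λ i → 0 ℕ.<ᵇ freq B i) (∈-allFin a) (ℕₚ.<⇒<ᵇ freq≥1)

  module _ (freq≥1 : ∀ a → 1 ≤ freq B a) where

    occ≡allFin : occ B ≡ allFin n
    occ≡allFin = filter-all (T? ∘ λ i → 0 ℕ.<ᵇ freq B i) (All.tabulate λ {a} _ → ℕₚ.<⇒<ᵇ (freq≥1 a))

    handicap≡∑ : handicap B ≡ ∑[ i < n ] (maxFreq B ∸ freq B i)
    handicap≡∑ = trans (cong (λ L → sum (map (λ i → maxFreq B ∸ freq B i) L)) occ≡allFin)
                       (sum-map-allFin n (λ i → maxFreq B ∸ freq B i))

    handicap-balance : SubsetOfC B → handicap B + 2 * length B ≡ n * maxFreq B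
    handicap-balance B⊆C = begin
      handicap B + 2 * length B
        ≡⟨ cong₂ _+_ handicap≡∑ (sym (handshake B B⊆C)) ⟩
      ∑[ i < n ] (maxFreq B ∸ freq B i) + ∑[ i < n ] freq B i
        ≡⟨ ∑-distrib-+ (λ i → maxFreq B ∸ freq B i) (freq B) ⟨
      ∑[ i < n ] (maxFreq B ∸ freq B i + freq B i)
        ≡⟨ sum-cong-≗ (λ i → ℕₚ.m∸n+n≡m (freq≤maxFreq (freq≥1 i))) ⟩
      ∑[ i < n ] maxFreq B
        ≡⟨ ∑-const n (maxFreq B) ⟩
      n * maxFreq B ∎
      where open ≡-Reasoning

    leaf-exists : maxFreq B ≡ 2 → handicap B ≢ 0 → ∃ λ a → freq B a ≡ 1
    leaf-exists Δ≡2 h≢0 with Finₚ.any? (λ a → freq B a ℕ.≟ 1)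
    ... | yes leaf = leaf
    ... | no  ¬leaf = contradiction (trans handicap≡∑ (trans (sum-cong-≗ no-slack) (sum-replicate-zero n))) h≢0
      where
      freq≡2 : ∀ a → freq B a ≡ 2
      freq≡2 a = 1≤x≤2∧x≢1⇒x≡2 (freq≥1 a) (subst (freq B a ≤_) Δ≡2 (freq≤maxFreq (freq≥1 a))) (¬leaf ∘ (a ,_))
      no-slack : ∀ a → maxFreq B ∸ freq B a ≡ 0
      no-slack a = cong₂ _∸_ Δ≡2 (freq≡2 a)

module PathFromLeaf {m} {B : PairSet (suc m)} (B⊆C : SubsetOfC B) (B! : Unique B) (conn : Connected B)
  (freq≤2 : ∀ a → freq B a ≤ 2) {v₀ : Fin (suc m)} (leaf : freq B v₀ ≡ 1) where

  open Degrees B⊆C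

  v₀v₁ : ∃ (Edge B v₀)
  v₀v₁ = freq≥1⇒neighbour (ℕₚ.≤-reflexive (sym leaf))

  -- The fallback c is junk: next-spec only concerns vertices of degree at least 2.
  next : Fin (suc m) → Fin (suc m) → Fin (suc m)
  next c p with 2 ≤? freq B c
  ... | yes freq≥2 = proj₁ (freq≥2⇒other-neighbour B! freq≥2 p)
  ... | no  _      = c

  next-spec : ∀ {c} p → 2 ≤ freq B c → Edge B c (next c p) × next c p ≢ p
  next-spec {c} p freq≥2 with 2 ≤? freq B c
  ... | yes freq≥2′ = proj₂ (freq≥2⇒other-neighbour B! freq≥2′ p)
  ... | no  freq≱2  = contradiction freq≥2 freq≱2

  step : ℕ → Fin (suc m) × Fin (suc m)
  step zero    = v₀ , proj₁ v₀v₁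
  step (suc k) = proj₂ (step k) , next (proj₂ (step k)) (proj₁ (step k))

  w : ℕ → Fin (suc m)
  w k = proj₁ (step k)

  record IsPathUpTo (k : ℕ) : Set where
    field
      edge      : ∀ {i} → i < k → Edge B (w i) (w (suc i))
      injective : InjectiveUpTo w k
  open IsPathUpTo

  walk-neighbour : ∀ {k i x} → IsPathUpTo k → i < k → Edge B (w i) x → ∃ λ j → j ≤ suc i × w j ≡ x
  walk-neighbour {i = zero} _ _ v₀x =
    1 , ℕₚ.≤-refl , sym (freq≤1⇒neighbour-unique (ℕₚ.≤-reflexive leaf) v₀x (proj₂ v₀v₁))
  walk-neighbour {i = suc i} path i+1<k w[i+1]x
    with freq≤2⇒neighbour∈ (freq≤2 _) (Edge-sym (edge path (ℕₚ.<-trans (ℕₚ.n<1+n i) i+1<k)))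
                           (edge path i+1<k) w[i]≢w[i+2] w[i+1]x
    where
    w[i]≢w[i+2] : w i ≢ w (suc (suc i))
    w[i]≢w[i+2] eq = ℕₚ.<-irrefl (injective path (ℕₚ.≤-trans (ℕₚ.n≤1+n i) (ℕₚ.<⇒≤ i+1<k)) i+1<k eq)
                                  (ℕₚ.m<n⇒m<1+n (ℕₚ.n<1+n i))
  ... | inj₁ x≡w[i]   = i , ℕₚ.≤-trans (ℕₚ.n≤1+n i) (ℕₚ.n≤1+n (suc i)) , sym x≡w[i]
  ... | inj₂ x≡w[i+2] = suc (suc i) , ℕₚ.≤-refl , sym x≡w[i+2]

  Visited : ℕ → Fin (suc m) → Set
  Visited k v = ∃ λ j → j < suc k × w j ≡ v

  dead-end⇒covered : ∀ {k} → IsPathUpTo (suc k) → freq B (w (suc k)) ≤ 1 → ∀ v → Visited (suc k) v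
  dead-end⇒covered {k} path dead-end =
    closed⇒universal conn (λ v → ℕₚ.anyUpTo? (λ j → w j ≟ v) (suc (suc k))) closed (0 , s≤s z≤n , refl)
    where
    closed : ∀ {a b} → Edge B a b → Visited (suc k) a → Visited (suc k) b
    closed ab (j , j≤k+1 , refl) with ℕₚ.m≤n⇒m<n∨m≡n (ℕₚ.≤-pred j≤k+1)
    ... | inj₁ j<k+1 with walk-neighbour path j<k+1 ab
    ...   | j′ , j′≤j+1 , w[j′]≡b = j′ , s≤s (ℕₚ.≤-trans j′≤j+1 j<k+1) , w[j′]≡b
    closed ab (j , _ , refl) | inj₂ refl =
      k , s≤s (ℕₚ.n≤1+n k) , sym (freq≤1⇒neighbour-unique dead-end ab (Edge-sym (edge path ℕₚ.≤-refl)))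

  not-dead-end : ∀ {k} → IsPathUpTo (suc k) → suc (suc k) < suc m → 2 ≤ freq B (w (suc k))
  not-dead-end {k} path k+2<n with 2 ≤? freq B (w (suc k))
  ... | yes freq≥2 = freq≥2
  ... | no  freq≱2 = contradiction (covered⇒≤ w (dead-end⇒covered path (ℕₚ.≤-pred (ℕₚ.≰⇒> freq≱2))))
                                   (ℕₚ.<⇒≱ k+2<n)

  edge-ahead : ∀ k → suc k < suc m → IsPathUpTo k → Edge B (w k) (w (suc k))
  edge-ahead zero    _     _    = proj₂ v₀v₁
  edge-ahead (suc k) k+2<n path = proj₁ (next-spec (w k) (not-dead-end path k+2<n))

  no-backtrack : ∀ {k} → IsPathUpTo (suc k) → suc (suc k) < suc m → w (suc (suc k)) ≢ w k
  no-backtrack {k} path k+2<n = proj₂ (next-spec (w k) (not-dead-end path k+2<n))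

  consecutive : ∀ {k i j} → IsPathUpTo k → i < j → j ≤ k → Edge B (w i) (w j) → j ≡ suc i
  consecutive {i = i} {j} path i<j j≤k w[i]w[j] with walk-neighbour path (ℕₚ.<-≤-trans i<j j≤k) w[i]w[j]
  ... | j′ , j′≤i+1 , w[j′]≡w[j] = ℕₚ.≤-antisym (subst (_≤ suc i) j′≡j j′≤i+1) i<j
    where
    j′≡j : j′ ≡ j
    j′≡j = injective path (ℕₚ.≤-trans j′≤i+1 (ℕₚ.≤-trans i<j j≤k)) j≤k w[j′]≡w[j]

  fresh : ∀ {k j} → suc k < suc m → IsPathUpTo k → j ≤ k → w j ≢ w (suc k)
  fresh {k} {j} k+1<n path j≤k w[j]≡w[k+1] with ℕₚ.m≤n⇒m<n∨m≡n j≤k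
  ... | inj₂ refl = Edge⇒≢ (edge-ahead k k+1<n path) w[j]≡w[k+1]
  ... | inj₁ j<k
    with refl ← consecutive path j<k ℕₚ.≤-refl
                  (subst (λ x → Edge B x (w k)) (sym w[j]≡w[k+1]) (Edge-sym (edge-ahead k k+1<n path)))
    = no-backtrack path k+1<n (sym w[j]≡w[k+1])

  extend : ∀ {k} → suc k < suc m → IsPathUpTo k → IsPathUpTo (suc k)
  extend {k} k+1<n path = record
    { edge      = edge′
    ; injective = injectiveUpTo-suc (injective path) (fresh k+1<n path)
    }
    where
    edge′ : ∀ {i} → i < suc k → Edge B (w i) (w (suc i))
    edge′ i<k+1 with ℕₚ.m≤n⇒m<n∨m≡n (ℕₚ.≤-pred i<k+1)
    ... | inj₁ i<k = edge path i<k
    ... | inj₂ refl = edge-ahead k k+1<n path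

  path-upTo : ∀ k → k < suc m → IsPathUpTo k
  path-upTo zero    _     = record { edge = λ () ; injective = λ { z≤n z≤n _ → refl } }
  path-upTo (suc k) k+1<n = extend k+1<n (path-upTo k (ℕₚ.<⇒≤ k+1<n))

  whole : IsPathUpTo m
  whole = path-upTo m ℕₚ.≤-refl

  σ : Fin (suc m) → Fin (suc m)
  σ a = w (toℕ a)

  σ-injective : Injective _≡_ _≡_ σ
  σ-injective {a} {b} eq =
    Finₚ.toℕ-injective (injective whole (Finₚ.toℕ≤pred[n] a) (Finₚ.toℕ≤pred[n] b) eq)

  Edge⇒PathAdj : ∀ a b → Edge B a b → PathAdj σ a b
  Edge⇒PathAdj a b ab with injective⇒surjective σ-injective a | injective⇒surjective σ-injective b
  ... | x , refl | y , refl with ℕₚ.<-cmp (toℕ x) (toℕ y)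
  ... | tri< x<y _ _ = x , y , consecutive whole x<y (Finₚ.toℕ≤pred[n] y) ab , inj₁ (refl , refl)
  ... | tri≈ _ x≡y _ = contradiction (cong w x≡y) (Edge⇒≢ ab)
  ... | tri> _ _ y<x = y , x , consecutive whole y<x (Finₚ.toℕ≤pred[n] x) (Edge-sym ab) , inj₂ (refl , refl)

  σ-edge : ∀ {k k′} → toℕ k′ ≡ suc (toℕ k) → Edge B (σ k) (σ k′)
  σ-edge {k} {k′} k′≡k+1 =
    subst (Edge B (σ k) ∘ w) (sym k′≡k+1) (edge whole (subst (_≤ m) k′≡k+1 (Finₚ.toℕ≤pred[n] k′)))

  PathAdj⇒Edge : ∀ a b → PathAdj σ a b → Edge B a b
  PathAdj⇒Edge _ _ (_ , _ , k′≡k+1 , inj₁ (refl , refl)) = σ-edge k′≡k+1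
  PathAdj⇒Edge _ _ (_ , _ , k′≡k+1 , inj₂ (refl , refl)) = Edge-sym (σ-edge k′≡k+1)

  isHamiltonianPath : IsHamiltonianPath B
  isHamiltonianPath = σ , σ-injective , λ a b → Edge⇒PathAdj a b , PathAdj⇒Edge a b

module Balance {h m Δ : ℕ} (balance : h + 2 * m ≡ suc m * Δ) (Δ≥1 : 1 ≤ Δ) where

  suc[m]*2 : suc m * 2 ≡ 2 + 2 * m
  suc[m]*2 = trans (ℕₚ.*-comm (suc m) 2) (ℕₚ.*-suc 2 m)

  Δ≡1⇒h+m≡1 : Δ ≡ 1 → h + m ≡ 1
  Δ≡1⇒h+m≡1 refl = ℕₚ.+-cancelʳ-≡ m (h + m) 1 (begin
    h + m + m   ≡⟨ ℕₚ.+-assoc h m m ⟩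
    h + (m + m) ≡⟨ cong (λ x → h + (m + x)) (ℕₚ.+-identityʳ m) ⟨
    h + 2 * m   ≡⟨ balance ⟩
    suc m * 1   ≡⟨ ℕₚ.*-identityʳ (suc m) ⟩
    1 + m       ∎)
    where open ≡-Reasoning

  Δ≥2⇒h≥2 : 2 ≤ Δ → 2 ≤ h
  Δ≥2⇒h≥2 Δ≥2 = ℕₚ.+-cancelʳ-≤ (2 * m) 2 h (begin
    2 + 2 * m  ≡⟨ suc[m]*2 ⟨
    suc m * 2  ≤⟨ ℕₚ.*-monoʳ-≤ (suc m) Δ≥2 ⟩
    suc m * Δ  ≡⟨ balance ⟨
    h + 2 * m  ∎)
    where open ℕₚ.≤-Reasoning

  Δ≡1⊎Δ≥2 : Δ ≡ 1 ⊎ 2 ≤ Δ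
  Δ≡1⊎Δ≥2 = swap (map₂ sym (ℕₚ.m≤n⇒m<n∨m≡n Δ≥1))

  h≡0⇒m≡1 : h ≡ 0 → m ≡ 1
  h≡0⇒m≡1 refl with Δ≡1⊎Δ≥2
  ... | inj₁ Δ≡1 = Δ≡1⇒h+m≡1 Δ≡1
  ... | inj₂ Δ≥2 = contradiction (Δ≥2⇒h≥2 Δ≥2) λ ()

  h≢1 : 1 ≤ m → h ≢ 1
  h≢1 m≥1 refl with Δ≡1⊎Δ≥2
  ... | inj₁ Δ≡1 = ℕₚ.<⇒≢ m≥1 (sym (cong ℕ.pred (Δ≡1⇒h+m≡1 Δ≡1)))
  ... | inj₂ Δ≥2 = contradiction (Δ≥2⇒h≥2 Δ≥2) λ { (s≤s ()) }

  h≡2⇒Δ≡2 : h ≡ 2 → Δ ≡ 2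
  h≡2⇒Δ≡2 refl = ℕₚ.*-cancelˡ-≡ Δ 2 (suc m) (trans (sym balance) (sym suc[m]*2))

mainTheorem5 : (n : ℕ) → 1 < n → (A : Matrix n) → IsPC A → Consistent A →
    (B : PairSet n) → SubsetOfC B → Unique B → length B ≡ n ∸ 1 → IsGenerators A B →
    (handicap B ≡ 0 → n ≡ 2) × (handicap B ≢ 1) × (handicap B ≡ 2 → IsHamiltonianPath B)
mainTheorem5 (suc m) 1<n A pc cons B B⊆C B! |B|≡m gen =
  cong suc ∘ h≡0⇒m≡1 , h≢1 (ℕₚ.≤-pred 1<n) , h≡2⇒hamiltonian
  where
  conn : Connected B
  conn = generators⇒connected pc cons gen
  freq≥1 : ∀ a → 1 ≤ freq B a
  freq≥1 = connected⇒freq≥1 B B⊆C 1<n conn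
  balance : handicap B + 2 * m ≡ suc m * maxFreq B
  balance = subst (λ l → handicap B + 2 * l ≡ suc m * maxFreq B) |B|≡m (handicap-balance B freq≥1 B⊆C)
  maxFreq≥1 : 1 ≤ maxFreq B
  maxFreq≥1 = ℕₚ.≤-trans (freq≥1 Fin.zero) (freq≤maxFreq B (freq≥1 Fin.zero))
  open Balance {handicap B} {m} {maxFreq B} balance maxFreq≥1
  h≡2⇒hamiltonian : handicap B ≡ 2 → IsHamiltonianPath B
  h≡2⇒hamiltonian h≡2 = PathFromLeaf.isHamiltonianPath B⊆C B! conn freq≤2 (proj₂ leaf)
    where
    Δ≡2 : maxFreq B ≡ 2
    Δ≡2 = h≡2⇒Δ≡2 h≡2
    freq≤2 : ∀ a → freq B a ≤ 2
    freq≤2 a = subst (freq B a ≤_) Δ≡2 (freq≤maxFreq B (freq≥1 a))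
    leaf : ∃ λ a → freq B a ≡ 1
    leaf = leaf-exists B freq≥1 Δ≡2 (λ h≡0 → contradiction (trans (sym h≡2) h≡0) λ ())
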